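{- Let $\lambda$ be a partition with $N$ boxes, $T\in\mathrm{SYT}(\lambda)$ and $j\in\{1,\dots,\lfloor N/2\rfloor\}$. Then $f^j(T)_{\le N+1-2j}=P^j(T)_{\le N+1-2j}$. In particular, the entry $N+1-2j$ lies in the same box of $F(T)$ as it does in $P^j(T)$.
   Context: $\mathrm{SYT}(\lambda)$ is the set of standard Young tableaux of shape $\lambda$ with entries $1,\dots,N$; $T_{\le k}$ is the subtableau of entries $\le k$. Promotion $P$: delete the entry $1$, slide into the empty box repeatedly the smaller of the entries immediately right of and below it until none exist, subtract $1$ from all entries, put $N$ into the empty box. For $k=1,\dots,N$, $P_k(T)$ is characterized by $P_k(T)_{>k}=T_{>k}$ and $P_k(T)_{\le k}=P(T_{\le k})$. For $j=1,\dots,\lfloor N/2\rfloor$, $f^j=P_{N-2j+2}\circ P_{N-2j+4}\circ\cdots\circ P_N$, and folding is $F=f^{\lfloor N/2\rfloor}$. -}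

module Defs where

open import Data.Nat using (ℕ; zero; suc; _+_; _*_; _∸_; _≤_; _<_; _<ᵇ_; _≤ᵇ_; _≡ᵇ_; ⌊_/2⌋)
open import Data.Bool using (Bool; true; false; if_then_else_; _∧_)
open import Data.List using (List; []; _∷_)
open import Data.Nat.ListAction using (sum)
open import Data.Product using (_×_; _,_)
open import Relation.Binary.PropositionalEquality using (_≡_)

-- A partition is a list of row lengths λ₁ ≥ λ₂ ≥ … ≥ λ_ℓ > 0 (English notation,
-- rows and columns indexed from 0).
data IsPartition : List ℕ → Set where
  []-part  : IsPartition []
  [x]-part : ∀ {a} → 1 ≤ a → IsPartition (a ∷ [])
  ∷-part   : ∀ {a b rest} → b ≤ a → IsPartition (b ∷ rest) → IsPartition (a ∷ b ∷ rest)

size : List ℕ → ℕ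
size = sum

rowLen : List ℕ → ℕ → ℕ
rowLen []       _       = 0
rowLen (a ∷ _)  zero    = a
rowLen (_ ∷ as) (suc r) = rowLen as r

InShape : List ℕ → ℕ → ℕ → Set
InShape sh r c = c < rowLen sh r

inShapeᵇ : List ℕ → ℕ → ℕ → Bool
inShapeᵇ sh r c = c <ᵇ rowLen sh r

-- A filling: the entry in row r, column c (values outside the diagram are irrelevant).
Tab : Set
Tab = ℕ → ℕ → ℕ

-- Standard Young tableau of shape λ with entries 1 … |λ|:
-- distinct entries in {1,…,N} on the N boxes (hence a bijection onto {1,…,N}),
-- strictly increasing along rows and down columns.
record IsSYT (sh : List ℕ) (T : Tab) : Set where
  field
    range    : ∀ r c → InShape sh r c → 1 ≤ T r c × T r c ≤ size sh
    distinct : ∀ r c r' c' → InShape sh r c → InShape sh r' c' →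
               T r c ≡ T r' c' → (r ≡ r') × (c ≡ c')
    rowInc   : ∀ r c → InShape sh r (suc c) → T r c < T r (suc c)
    colInc   : ∀ r c → InShape sh (suc r) c → T r c < T (suc r) c

set : Tab → ℕ → ℕ → ℕ → Tab
set T r c v r' c' = if (r' ≡ᵇ r) ∧ (c' ≡ᵇ c) then v else T r' c'

-- Jeu-de-taquin slide of the empty box at (r , c) inside the region S
-- (fuel bounds the number of slides; each slide increases r + c, so |λ| suffices).
slide : ℕ → (ℕ → ℕ → Bool) → Tab → ℕ → ℕ → Tab × (ℕ × ℕ)
slide zero     S T r c = T , (r , c)
slide (suc f) S T r c with S r (suc c) | S (suc r) c
... | false | false = T , (r , c)
... | true  | false = slide f S (set T r c (T r (suc c))) r (suc c)
... | false | true  = slide f S (set T r c (T (suc r) c)) (suc r) c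
... | true  | true  =
  if T r (suc c) <ᵇ T (suc r) c
  then slide f S (set T r c (T r (suc c))) r (suc c)
  else slide f S (set T r c (T (suc r) c)) (suc r) c

-- Promotion of the standard subtableau occupying region S (entries 1 … n):
-- delete the entry 1 (which sits in the corner box (0,0) of any nonempty SYT),
-- slide, subtract 1 from all entries in S, put n in the vacated box.
promoteIn : ℕ → (ℕ → ℕ → Bool) → ℕ → Tab → Tab
promoteIn fuel S n T r c with slide fuel S T 0 0
... | T' , (a , b) =
  if S r c
  then (if (r ≡ᵇ a) ∧ (c ≡ᵇ b) then n else T' r c ∸ 1)
  else T r c

P : List ℕ → Tab → Tab
P sh T = promoteIn (size sh) (inShapeᵇ sh) (size sh) T

Pk : List ℕ → ℕ → Tab → Tab
Pk sh k T = promoteIn (size sh) (λ r c → inShapeᵇ sh r c ∧ (T r c ≤ᵇ k)) k T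

Ppow : List ℕ → ℕ → Tab → Tab
Ppow sh zero    T = T
Ppow sh (suc j) T = P sh (Ppow sh j T)

-- f^j = P_{N-2j+2} ∘ P_{N-2j+4} ∘ ⋯ ∘ P_N ;  f^0 = id, f^{j+1} = P_{N-2j} ∘ f^j
fpow : List ℕ → ℕ → Tab → Tab
fpow sh zero    T = T
fpow sh (suc j) T = Pk sh (size sh ∸ 2 * j) (fpow sh j T)

Fold : List ℕ → Tab → Tab
Fold sh = fpow sh ⌊ size sh /2⌋

{-# OPTIONS --safe #-}
-- Promotion of the entries ≤ k only depends on them: the jeu-de-taquin path from the corner
-- passes through increasing entries, so its part through entries ≤ k, and with it the entries
-- ≤ k − 1 of the result, is determined by the entries ≤ k, provided rows and columns increase
-- among them (a property that promotion passes on from ≤ k to ≤ k − 1). Since f^{j+1} applies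
-- P_{N−2j} where P^{j+1} applies P = P_N, induction on j shows that f^j(T) and P^j(T) agree on
-- entries ≤ N + 1 − 2j. The remaining factors P_{N−2i}, i ≥ j, of F never move an entry larger
-- than N − 2j, so N + 1 − 2j sits in the same box of F(T) as of f^j(T).
module Submission where

open import Defs
open import Data.Bool using (Bool; true; false; _∧_) renaming (T to IsTrue)
open import Data.Bool.Properties using (T-≡; T-∧; ¬-not) renaming (_≟_ to _≟ᵇ_)
open import Data.Empty using (⊥-elim)
open import Data.List using (List; _∷_)
open import Data.Maybe using (Maybe; just; nothing; _>>=_)
open import Data.Maybe.Properties using (just-injective) renaming (≡-dec to ≡-dec-Maybe)
open import Data.Product.Properties using () renaming (≡-dec to ≡-dec-×)
open import Data.Nat using (ℕ; zero; suc; _+_; _*_; _∸_; _≤_; _<_; _<ᵇ_; _≤ᵇ_; _≡ᵇ_; ⌊_/2⌋; ⌈_/2⌉; z≤n; s≤s; z<s)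
open import Data.Nat.Properties
open import Data.Product using (_×_; _,_; proj₁; proj₂; ∃-syntax)
open import Data.Sum using (_⊎_; inj₁; inj₂)
open import Function using (_⇔_; mk⇔; Equivalence)
open import Function.Properties.Equivalence using () renaming (refl to ⇔-refl; trans to ⇔-trans)
open import Relation.Nullary using (¬_; Dec; yes; no; contradiction)
open import Relation.Binary.PropositionalEquality

Box : Set
Box = ℕ × ℕ

Region : Set
Region = ℕ → ℕ → Bool

entry : Tab → Box → ℕ
entry T (r , c) = T r c

_∋_ : Region → Box → Set
S ∋ (r , c) = S r c ≡ true

_∈?_ : ∀ (x : Box) S → Dec (S ∋ x)
(r , c) ∈? S = S r c ≟ᵇ true

Inside : List ℕ → Box → Set
Inside sh (r , c) = InShape sh r c

_≟ᴮ_ : (x y : Box) → Dec (x ≡ y)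
_≟ᴮ_ = ≡-dec-× _≟_ _≟_

diag : Box → ℕ
diag (r , c) = r + c

data _⋖_ : Box → Box → Set where
  right : ∀ {r c} → (r , c) ⋖ (r , suc c)
  below : ∀ {r c} → (r , c) ⋖ (suc r , c)

diag-⋖ : ∀ {x y} → x ⋖ y → diag y ≡ suc (diag x)
diag-⋖ (right {r} {c}) = +-suc r c
diag-⋖ below           = refl

≡ᵇ-refl : ∀ n → (n ≡ᵇ n) ≡ true
≡ᵇ-refl zero    = refl
≡ᵇ-refl (suc n) = ≡ᵇ-refl n

box-≡ᵇ-true : ∀ {r c a b} → (r , c) ≡ (a , b) → ((r ≡ᵇ a) ∧ (c ≡ᵇ b)) ≡ true
box-≡ᵇ-true {r} {c} refl rewrite ≡ᵇ-refl r | ≡ᵇ-refl c = refl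

box-≡ᵇ-false : ∀ {r c a b} → (r , c) ≢ (a , b) → ((r ≡ᵇ a) ∧ (c ≡ᵇ b)) ≡ false
box-≡ᵇ-false {r} {c} {a} {b} ne with r ≡ᵇ a in r≡a | c ≡ᵇ b in c≡b
... | false | _     = refl
... | true  | false = refl
... | true  | true  = ⊥-elim (ne (cong₂ _,_ (≡ᵇ⇒≡ r a (Equivalence.from T-≡ r≡a))
                                            (≡ᵇ⇒≡ c b (Equivalence.from T-≡ c≡b))))

set-≡ : ∀ T r c v → set T r c v r c ≡ v
set-≡ T r c v rewrite box-≡ᵇ-true {r} {c} refl = refl

set-≢ : ∀ T r c v {x} → x ≢ (r , c) → entry (set T r c v) x ≡ entry T x
set-≢ T r c v {_ , _} ne rewrite box-≡ᵇ-false ne = refl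

nextBox : Region → Tab → Box → Maybe Box
nextBox S T (r , c) = choose (S r (suc c)) (S (suc r) c) (T r (suc c) <ᵇ T (suc r) c)
  where
  choose : Bool → Bool → Bool → Maybe Box
  choose false false _     = nothing
  choose true  false _     = just (r , suc c)
  choose false true  _     = just (suc r , c)
  choose true  true  true  = just (r , suc c)
  choose true  true  false = just (suc r , c)

nextBox-cong : ∀ S T T′ r c → T r (suc c) ≡ T′ r (suc c) → T (suc r) c ≡ T′ (suc r) c →
               nextBox S T (r , c) ≡ nextBox S T′ (r , c)
nextBox-cong S T T′ r c eqʳ eqᵇ rewrite eqʳ | eqᵇ = refl

slideStep : ℕ → Region → Tab → Box → Maybe Box → Tab × Box
slideStep f S T x       nothing          = T , x
slideStep f S T (r , c) (just (r′ , c′)) = slide f S (set T r c (T r′ c′)) r′ c′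

slide-suc : ∀ f S T r c → slide (suc f) S T r c ≡ slideStep f S T (r , c) (nextBox S T (r , c))
slide-suc f S T r c with S r (suc c) | S (suc r) c
... | false | false = refl
... | true  | false = refl
... | false | true  = refl
... | true  | true with T r (suc c) <ᵇ T (suc r) c
...   | true  = refl
...   | false = refl

data NextBox (S : Region) (T : Tab) : Box → Box → Set where
  goRight : ∀ {r c} → S r (suc c) ≡ true → (S (suc r) c ≡ true → T r (suc c) < T (suc r) c) →
            NextBox S T (r , c) (r , suc c)
  goDown  : ∀ {r c} → S (suc r) c ≡ true → (S r (suc c) ≡ true → T (suc r) c ≤ T r (suc c)) →
            NextBox S T (r , c) (suc r , c)

nextBox-sound : ∀ S T x {z} → nextBox S T x ≡ just z → NextBox S T x z
nextBox-sound S T (r , c) eq with S r (suc c) in inʳ | S (suc r) c in inᵇ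
nextBox-sound S T (r , c) ()   | false | false
nextBox-sound S T (r , c) refl | true  | false = goRight inʳ (λ h → contradiction (trans (sym inᵇ) h) λ ())
nextBox-sound S T (r , c) refl | false | true  = goDown inᵇ (λ h → contradiction (trans (sym inʳ) h) λ ())
nextBox-sound S T (r , c) eq   | true  | true with T r (suc c) <ᵇ T (suc r) c in lt
nextBox-sound S T (r , c) refl | true  | true | true  = goRight inʳ (λ _ → <ᵇ⇒< _ _ (Equivalence.from T-≡ lt))
nextBox-sound S T (r , c) refl | true  | true | false = goDown inᵇ (λ _ → ≮⇒≥ (λ h → subst IsTrue lt (<⇒<ᵇ h)))

nextBox-complete : ∀ {S T x z} → NextBox S T x z → nextBox S T x ≡ just z
nextBox-complete {S} {T} (goRight {r} {c} inʳ less) with S r (suc c) | S (suc r) c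
... | true | false = refl
... | true | true with T r (suc c) <ᵇ T (suc r) c in lt
...   | true  = refl
...   | false = contradiction (<⇒<ᵇ (less refl)) (subst IsTrue lt)
nextBox-complete {S} {T} (goDown {r} {c} inᵇ notLess) with S r (suc c) | S (suc r) c
... | false | true = refl
... | true  | true with T r (suc c) <ᵇ T (suc r) c in lt
...   | true  = contradiction (notLess refl) (<⇒≱ (<ᵇ⇒< _ _ (Equivalence.from T-≡ lt)))
...   | false = refl

nextBox-⋖ : ∀ {S T x z} → NextBox S T x z → x ⋖ z × S ∋ z
nextBox-⋖ (goRight inʳ _) = right , inʳ
nextBox-⋖ (goDown inᵇ _)  = below , inᵇ

nextBox-min : ∀ {S T x y z} → NextBox S T x z → x ⋖ y → S ∋ y → entry T z ≤ entry T y
nextBox-min (goRight _ _)    right _   = ≤-refl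
nextBox-min (goRight _ less) below inᵇ = <⇒≤ (less inᵇ)
nextBox-min (goDown _ notLess) right inʳ = notLess inʳ
nextBox-min (goDown _ _)     below _   = ≤-refl

nextBox-stuck : ∀ {S T x y} → nextBox S T x ≡ nothing → x ⋖ y → ¬ S ∋ y
nextBox-stuck {S} {T} stuck (right {r} {c}) y∈S with S r (suc c) | S (suc r) c
nextBox-stuck stuck right ()  | false | _
nextBox-stuck ()    right y∈S | true  | false
nextBox-stuck {T = T} stuck (right {r} {c}) y∈S | true | true with T r (suc c) <ᵇ T (suc r) c
nextBox-stuck () right y∈S | true | true | true
nextBox-stuck () right y∈S | true | true | false
nextBox-stuck {S} {T} stuck (below {r} {c}) y∈S with S r (suc c) | S (suc r) c
nextBox-stuck stuck below ()  | _     | false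
nextBox-stuck ()    below y∈S | false | true
nextBox-stuck {T = T} stuck (below {r} {c}) y∈S | true | true with T r (suc c) <ᵇ T (suc r) c
nextBox-stuck () below y∈S | true | true | true
nextBox-stuck () below y∈S | true | true | false

path : Region → Tab → ℕ → Box → Maybe Box
path S T zero    x = just x
path S T (suc i) x = path S T i x >>= nextBox S T

path-front : ∀ {S T x z} → nextBox S T x ≡ just z → ∀ i → path S T (suc i) x ≡ path S T i z
path-front next zero    = next
path-front {S} {T} next (suc i) = cong (_>>= nextBox S T) (path-front next i)

path-stuck : ∀ {S T x} → nextBox S T x ≡ nothing → ∀ i → path S T (suc i) x ≡ nothing
path-stuck stuck zero    = stuck
path-stuck {S} {T} stuck (suc i) = cong (_>>= nextBox S T) (path-stuck stuck i)

path-last : ∀ {S T} i x {z} → path S T (suc i) x ≡ just z → ∃[ y ] path S T i x ≡ just y × nextBox S T y ≡ just z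
path-last {S} {T} i x eq with path S T i x
... | just y = y , refl , eq

path-diag : ∀ {S T} i x {y} → path S T i x ≡ just y → diag y ≡ diag x + i
path-diag zero x refl = sym (+-identityʳ (diag x))
path-diag {S} {T} (suc i) x {z} eq =
  let (y , on , next) = path-last i x eq
      (y⋖z , _) = nextBox-⋖ (nextBox-sound S T y next)
  in begin
    diag z           ≡⟨ diag-⋖ y⋖z ⟩
    suc (diag y)     ≡⟨ cong suc (path-diag i x on) ⟩
    suc (diag x + i) ≡⟨ sym (+-suc (diag x) i) ⟩
    diag x + suc i   ∎
  where open ≡-Reasoning

record SlideSpec (S : Region) (T cur : Tab) (x : Box) (result : Tab × Box) : Set where
  field
    holeOnPath : ∃[ i ] path S T i x ≡ just (proj₂ result)
    holeStuck  : nextBox S T (proj₂ result) ≡ nothing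
    onPath     : ∀ i y → path S T i x ≡ just y → y ≢ proj₂ result →
                 ∃[ z ] nextBox S T y ≡ just z × entry (proj₁ result) y ≡ entry T z
    offPath    : ∀ y → (∀ i → path S T i x ≢ just y) → entry (proj₁ result) y ≡ entry cur y

stuck-spec : ∀ {S T} cur x → nextBox S T x ≡ nothing → SlideSpec S T cur x (cur , x)
stuck-spec {S} {T} cur x stuck = record
  { holeOnPath = 0 , refl
  ; holeStuck  = stuck
  ; onPath     = onPath
  ; offPath    = λ _ _ → refl
  }
  where
  onPath : ∀ i y → path S T i x ≡ just y → y ≢ x → _
  onPath zero    y refl y≢x = contradiction refl y≢x
  onPath (suc i) y on   _   = contradiction (trans (sym (path-stuck stuck i)) on) λ ()

nextBox-beyond : ∀ {S T B} x → (∀ {y} → S ∋ y → diag y ≤ B) → B ≤ diag x → nextBox S T x ≡ nothing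
nextBox-beyond {S} {T} x bounded B≤x with nextBox S T x in next
... | nothing = refl
... | just z  =
  let (x⋖z , z∈S) = nextBox-⋖ (nextBox-sound S T x next)
  in contradiction (≤-trans (bounded z∈S) B≤x) (<⇒≱ (≤-reflexive (sym (diag-⋖ x⋖z))))

-- The slide reads the current filling `cur` only beyond the anti-diagonal of the hole, where it
-- still agrees with T; hence the path of the slide is the one `nextBox` traces in T.
slide-spec : ∀ f S T cur r c → (∀ {y} → S ∋ y → diag y ≤ f + (r + c)) →
             (∀ {y} → r + c < diag y → entry cur y ≡ entry T y) →
             SlideSpec S T cur (r , c) (slide f S cur r c)
slide-spec zero S T cur r c bounded ahead =
  stuck-spec cur (r , c) (nextBox-beyond {T = T} (r , c) (λ {y} → bounded {y}) ≤-refl)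
slide-spec (suc f) S T cur r c bounded ahead =
  subst (SlideSpec S T cur (r , c)) (sym (slide-suc f S cur r c))
        (step (nextBox S cur (r , c)) nextBox-cur)
  where
  nextBox-cur : nextBox S cur (r , c) ≡ nextBox S T (r , c)
  nextBox-cur = nextBox-cong S cur T r c (ahead {r , suc c} (≤-reflexive (sym (+-suc r c)))) (ahead {suc r , c} ≤-refl)

  step : ∀ m → m ≡ nextBox S T (r , c) → SlideSpec S T cur (r , c) (slideStep f S cur (r , c) m)
  step nothing          stuck = stuck-spec cur (r , c) (sym stuck)
  step (just (r′ , c′)) eq    = record
    { holeOnPath = suc (proj₁ IH.holeOnPath) ,
                   trans (path-front next (proj₁ IH.holeOnPath)) (proj₂ IH.holeOnPath)
    ; holeStuck  = IH.holeStuck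
    ; onPath     = onPath
    ; offPath    = offPath
    }
    where
    next : nextBox S T (r , c) ≡ just (r′ , c′)
    next = sym eq
    diag-z : r′ + c′ ≡ suc (r + c)
    diag-z = diag-⋖ (proj₁ (nextBox-⋖ (nextBox-sound S T (r , c) next)))
    x<z : r + c < r′ + c′
    x<z = ≤-reflexive (sym diag-z)
    behind : ∀ {y} → r + c < diag y → y ≢ (r , c)
    behind lt refl = <-irrefl refl lt
    module IH = SlideSpec (slide-spec f S T (set cur r c (cur r′ c′)) r′ c′
      (λ {y} y∈S → subst (diag y ≤_) (trans (sym (+-suc f (r + c))) (cong (f +_) (sym diag-z))) (bounded y∈S))
      (λ lt → trans (set-≢ cur r c _ (behind (<-trans x<z lt))) (ahead (<-trans x<z lt))))
    not-after : ∀ i → path S T i (r′ , c′) ≢ just (r , c)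
    not-after i on = <-irrefl (path-diag i (r′ , c′) on) (<-≤-trans x<z (m≤m+n _ i))
    onPath : ∀ i y → path S T i (r , c) ≡ just y → y ≢ _ → ∃[ z ] nextBox S T y ≡ just z × _
    onPath zero    y refl _   = (r′ , c′) , next ,
      trans (IH.offPath (r , c) not-after) (trans (set-≡ cur r c _) (ahead x<z))
    onPath (suc i) y on   y≢hole = IH.onPath i y (trans (sym (path-front next i)) on) y≢hole
    offPath : ∀ y → (∀ i → path S T i (r , c) ≢ just y) → _
    offPath y off = trans (IH.offPath y (λ i on → off (suc i) (trans (path-front next i) on)))
                          (set-≢ cur r c _ (λ { refl → off 0 refl }))

partition-head-pos : ∀ {a as} → IsPartition (a ∷ as) → 1 ≤ a
partition-head-pos ([x]-part 1≤a)   = 1≤a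
partition-head-pos (∷-part b≤a ip) = ≤-trans (partition-head-pos ip) b≤a

diag<size : ∀ {sh} → IsPartition sh → ∀ {x} → Inside sh x → diag x < size sh
diag<size {a ∷ as}       _               {zero  , c} c<a = ≤-trans c<a (m≤m+n a (size as))
diag<size {a ∷ b ∷ rest} (∷-part b≤a ip) {suc r , c} x∈  =
  +-mono-≤ (≤-trans (partition-head-pos ip) b≤a) (diag<size ip {r , c} x∈)

Increasing : List ℕ → ℕ → Tab → Set
Increasing sh K T = ∀ {x y} → x ⋖ y → Inside sh x → Inside sh y → entry T y ≤ K → entry T x ≤ entry T y

module Promotion {sh : List ℕ} (ip : IsPartition sh) (S : Region) (T : Tab)
                 (S⊆sh : ∀ {x} → S ∋ x → Inside sh x) where

  result : Tab × Box
  result = slide (size sh) S T 0 0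

  slid : Tab
  slid = proj₁ result

  hole : Box
  hole = proj₂ result

  spec : SlideSpec S T T (0 , 0) result
  spec = slide-spec (size sh) S T T 0 0
           (λ {y} y∈S → ≤-trans (<⇒≤ (diag<size ip (S⊆sh {y} y∈S))) (m≤m+n _ 0)) (λ _ → refl)

  OnPath OffPath : Box → Set
  OnPath  x = ∃[ i ] path S T i (0 , 0) ≡ just x
  OffPath x = ∀ i → path S T i (0 , 0) ≢ just x

  data Fate (x : Box) : Set where
    moved : ∀ {z} → OnPath x → nextBox S T x ≡ just z → entry slid x ≡ entry T z → Fate x
    kept  : OffPath x → entry slid x ≡ entry T x → Fate x

  fate : ∀ x → x ≢ hole → Fate x
  fate x x≢hole with ≡-dec-Maybe _≟ᴮ_ (path S T (diag x) (0 , 0)) (just x)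
  ... | yes on =
    let (z , next , slid≡) = SlideSpec.onPath spec (diag x) x on x≢hole
    in moved (diag x , on) next slid≡
  ... | no off = kept off′ (SlideSpec.offPath spec x off′)
    where
    off′ : OffPath x
    off′ i on = off (subst (λ i → path S T i (0 , 0) ≡ just x) (sym (path-diag i (0 , 0) on)) on)

  hole-onPath : OnPath hole
  hole-onPath = SlideSpec.holeOnPath spec

  hole-nextBox : nextBox S T hole ≡ nothing
  hole-nextBox = SlideSpec.holeStuck spec

  hole-stuck : ∀ {x y} → x ⋖ y → S ∋ y → x ≢ hole
  hole-stuck x⋖y y∈S refl = nextBox-stuck {S} {T} hole-nextBox x⋖y y∈S

  promoted : ℕ → Tab
  promoted n = promoteIn (size sh) S n T

  promoted-outside : ∀ n {x} → ¬ S ∋ x → entry (promoted n) x ≡ entry T x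
  promoted-outside n {r , c} x∉S with slide (size sh) S T 0 0
  ... | _ rewrite ¬-not x∉S = refl

  promoted-hole : ∀ n {x} → S ∋ x → x ≡ hole → entry (promoted n) x ≡ n
  promoted-hole n {r , c} x∈S x≡hole with slide (size sh) S T 0 0
  ... | _ rewrite x∈S | box-≡ᵇ-true x≡hole = refl

  promoted-moved : ∀ n {x} → S ∋ x → x ≢ hole → entry (promoted n) x ≡ entry slid x ∸ 1
  promoted-moved n {r , c} x∈S x≢hole with slide (size sh) S T 0 0
  ... | _ rewrite x∈S | box-≡ᵇ-false x≢hole = refl

  data PromotedEntry (n : ℕ) (x : Box) : Set where
    outside : ¬ S ∋ x → entry (promoted n) x ≡ entry T x → PromotedEntry n x
    atHole  : S ∋ x → x ≡ hole → entry (promoted n) x ≡ n → PromotedEntry n x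
    shifted : S ∋ x → x ≢ hole → entry (promoted n) x ≡ entry slid x ∸ 1 → PromotedEntry n x

  promoted-entry : ∀ n x → PromotedEntry n x
  promoted-entry n x with x ∈? S
  ... | no x∉S = outside x∉S (promoted-outside n x∉S)
  ... | yes x∈S with x ≟ᴮ hole
  ...   | yes x≡hole = atHole x∈S x≡hole (promoted-hole n x∈S x≡hole)
  ...   | no  x≢hole = shifted x∈S x≢hole (promoted-moved n x∈S x≢hole)

  slid-≤ : ∀ {b} → (∀ {x} → S ∋ x → entry T x ≤ b) → ∀ {x} → S ∋ x → x ≢ hole → entry slid x ≤ b
  slid-≤ {b} S≤b {x} x∈S x≢hole with fate x x≢hole
  ... | moved _ next slid≡ = subst (_≤ b) (sym slid≡) (S≤b (proj₂ (nextBox-⋖ (nextBox-sound S T x next))))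
  ... | kept _ slid≡       = subst (_≤ b) (sym slid≡) (S≤b x∈S)

  promoted-≤ : ∀ {b n} → (∀ {x} → S ∋ x → entry T x ≤ b) → n ≤ b →
               ∀ {x} → S ∋ x → entry (promoted n) x ≤ b
  promoted-≤ {b} {n} S≤b n≤b {x} x∈S with promoted-entry n x
  ... | outside x∉S _          = contradiction x∈S x∉S
  ... | atHole _ _ eq          = subst (_≤ b) (sym eq) n≤b
  ... | shifted _ x≢hole eq    = subst (_≤ b) (sym eq) (≤-trans (m∸n≤m _ 1) (slid-≤ S≤b x∈S x≢hole))

  module _ {K} (inc : Increasing sh K T) where

    slid-≥ : ∀ {y} → Inside sh y → y ≢ hole → entry slid y ≤ K → entry T y ≤ entry slid y
    slid-≥ {y} y∈ y≢hole slid≤K with fate y y≢hole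
    ... | moved _ next slid≡ =
      let (y⋖z , z∈S) = nextBox-⋖ (nextBox-sound S T y next)
      in subst (entry T y ≤_) (sym slid≡) (inc y⋖z y∈ (S⊆sh z∈S) (subst (_≤ K) slid≡ slid≤K))
    ... | kept _ slid≡ = ≤-reflexive (sym slid≡)

    slid-≤-successor : ∀ {x y} → x ⋖ y → Inside sh x → Inside sh y → S ∋ y → entry T y ≤ K →
                       entry slid x ≤ entry T y
    slid-≤-successor {x} {y} x⋖y x∈ y∈ y∈S Ty≤K with fate x (hole-stuck x⋖y y∈S)
    ... | moved _ next slid≡ = subst (_≤ entry T y) (sym slid≡) (nextBox-min (nextBox-sound S T x next) x⋖y y∈S)
    ... | kept _ slid≡       = subst (_≤ entry T y) (sym slid≡) (inc x⋖y x∈ y∈ Ty≤K)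

record SlideRegion (sh : List ℕ) (k : ℕ) (T : Tab) (S : Region) : Set where
  field
    ⊆shape     : ∀ {x} → S ∋ x → Inside sh x
    ⊇small     : ∀ {x} → Inside sh x → entry T x ≤ k → S ∋ x
    increasing : Increasing sh k T

m∸1≤n∸1⇒m≤n : ∀ {m n} → 1 ≤ n → m ∸ 1 ≤ n ∸ 1 → m ≤ n
m∸1≤n∸1⇒m≤n {zero}          _ _  = z≤n
m∸1≤n∸1⇒m≤n {suc m} {suc n} _ le = s≤s le

module _ {sh K T S} (ip : IsPartition sh) (reg : SlideRegion sh K T S) where
  open SlideRegion reg
  open Promotion ip S T ⊆shape

  small-promoted : ∀ {n x} → 1 ≤ K → K ≤ n → Inside sh x → entry (promoted n) x ≤ K ∸ 1 →
                   S ∋ x × x ≢ hole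
  small-promoted {n} {x} 1≤K K≤n x∈ small with promoted-entry n x
  ... | outside x∉S eq = contradiction (⊇small x∈ (≤-trans (subst (_≤ K ∸ 1) eq small) (m∸n≤m K 1))) x∉S
  ... | atHole _ _ eq  = contradiction (subst (_≤ K ∸ 1) eq small) (<⇒≱ (<-≤-trans (∸-monoʳ-< z<s 1≤K) K≤n))
  ... | shifted x∈S x≢hole _ = x∈S , x≢hole

  promoteIn-increasing : ∀ {n} → 1 ≤ K → K ≤ n → Increasing sh (K ∸ 1) (promoteIn (size sh) S n T)
  promoteIn-increasing {n} 1≤K K≤n {x} {y} x⋖y x∈ y∈ Oy≤ = begin
      entry (promoted n) x ≡⟨ promoted-moved n x∈S x≢hole ⟩
      entry slid x ∸ 1     ≤⟨ ∸-monoˡ-≤ 1 (slid-≤-successor increasing x⋖y x∈ y∈ y∈S Ty≤K) ⟩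
      entry T y ∸ 1        ≤⟨ ∸-monoˡ-≤ 1 Ty≤slid ⟩
      entry slid y ∸ 1     ≡⟨ promoted-moved n y∈S y≢hole ⟨
      entry (promoted n) y ∎
    where
    open ≤-Reasoning
    y∈S = proj₁ (small-promoted 1≤K K≤n y∈ Oy≤)
    y≢hole = proj₂ (small-promoted 1≤K K≤n y∈ Oy≤)
    slid≤K : entry slid y ≤ K
    slid≤K = m∸1≤n∸1⇒m≤n 1≤K (subst (_≤ K ∸ 1) (promoted-moved n y∈S y≢hole) Oy≤)
    Ty≤slid : entry T y ≤ entry slid y
    Ty≤slid = slid-≥ increasing y∈ y≢hole slid≤K
    Ty≤K : entry T y ≤ K
    Ty≤K = ≤-trans Ty≤slid slid≤K
    x≢hole : x ≢ hole
    x≢hole = hole-stuck x⋖y y∈S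
    x∈S : S ∋ x
    x∈S = ⊇small x∈ (≤-trans (increasing x⋖y x∈ y∈ Ty≤K) Ty≤K)

AgreeUpTo : List ℕ → ℕ → Tab → Tab → Set
AgreeUpTo sh k A B = ∀ r c → InShape sh r c → A r c ≤ k ⊎ B r c ≤ k → A r c ≡ B r c

AgreeUpTo-sym : ∀ {sh k A B} → AgreeUpTo sh k A B → AgreeUpTo sh k B A
AgreeUpTo-sym agree r c x∈ (inj₁ Bx≤k) = sym (agree r c x∈ (inj₂ Bx≤k))
AgreeUpTo-sym agree r c x∈ (inj₂ Ax≤k) = sym (agree r c x∈ (inj₁ Ax≤k))

module Transfer {sh k A B SA SB} (regA : SlideRegion sh k A SA) (regB : SlideRegion sh k B SB)
                (agree : AgreeUpTo sh k A B) where
  private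
    module A = SlideRegion regA
    module B = SlideRegion regB

  agreeᴬ : ∀ {x} → Inside sh x → entry A x ≤ k → entry A x ≡ entry B x
  agreeᴬ {r , c} x∈ Ax≤k = agree r c x∈ (inj₁ Ax≤k)

  agreeᴮ : ∀ {x} → Inside sh x → entry B x ≤ k → entry A x ≡ entry B x
  agreeᴮ {r , c} x∈ Bx≤k = agree r c x∈ (inj₂ Bx≤k)

  small∈SB : ∀ {x} → Inside sh x → entry A x ≤ k → SB ∋ x
  small∈SB x∈ Ax≤k = B.⊇small x∈ (subst (_≤ k) (agreeᴬ x∈ Ax≤k) Ax≤k)

  -- A box w is either ≤ k in B, hence equal in A and B, or above k, hence above every small entry.
  order-transfer : ∀ (R : ℕ → ℕ → Set) → (∀ {a b} → a ≤ k → k < b → R a b) →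
                   ∀ {z w} → Inside sh z → entry A z ≤ k →
                   (SA ∋ w → R (entry A z) (entry A w)) → SB ∋ w → R (entry B z) (entry B w)
  order-transfer R small-large {z} {w} z∈ Az≤k relA w∈SB with entry B w ≤? k
  ... | yes Bw≤k = subst₂ R (agreeᴬ z∈ Az≤k) (agreeᴮ w∈ Bw≤k)
                     (relA (A.⊇small w∈ (subst (_≤ k) (sym (agreeᴮ w∈ Bw≤k)) Bw≤k)))
    where w∈ = B.⊆shape w∈SB
  ... | no Bw≰k  = small-large (subst (_≤ k) (agreeᴬ z∈ Az≤k) Az≤k) (≰⇒> Bw≰k)

  nextBox-agree : ∀ {y z} → nextBox SA A y ≡ just z → entry A z ≤ k → nextBox SB B y ≡ just z
  nextBox-agree {y} next Az≤k with nextBox-sound SA A y next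
  ... | goRight inʳ less   = nextBox-complete {SB} {B} (goRight (small∈SB (A.⊆shape inʳ) Az≤k)
          (order-transfer _<_ ≤-<-trans (A.⊆shape inʳ) Az≤k less))
  ... | goDown inᵇ notLess = nextBox-complete {SB} {B} (goDown (small∈SB (A.⊆shape inᵇ) Az≤k)
          (order-transfer _≤_ (λ a≤k k<b → ≤-trans a≤k (<⇒≤ k<b)) (A.⊆shape inᵇ) Az≤k notLess))

  path-agree : ∀ i {x} → path SA A i (0 , 0) ≡ just x → (SA ∋ x → entry A x ≤ k) →
               path SB B i (0 , 0) ≡ just x
  path-agree zero    on _       = on
  path-agree (suc i) on x-small =
    let (y , onʸ , next) = path-last i (0 , 0) on
        (y⋖x , x∈SA)     = nextBox-⋖ (nextBox-sound SA A y next)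
        Ax≤k             = x-small x∈SA
        y-small : SA ∋ y → entry A y ≤ k
        y-small y∈SA = ≤-trans (A.increasing y⋖x (A.⊆shape y∈SA) (A.⊆shape x∈SA) Ax≤k) Ax≤k
    in trans (cong (_>>= nextBox SB B) (path-agree i onʸ y-small)) (nextBox-agree next Ax≤k)

module SlideAgreement {sh k A B SA SB} (ip : IsPartition sh)
                      (regA : SlideRegion sh k A SA) (regB : SlideRegion sh k B SB)
                      (agree : AgreeUpTo sh k A B) where
  private
    module A = SlideRegion regA
    module PA = Promotion ip SA A A.⊆shape
    module PB = Promotion ip SB B (SlideRegion.⊆shape regB)
    module Back = Transfer regB regA (AgreeUpTo-sym {sh} agree)
  open Transfer regA regB agree

  slid-agree : ∀ {x} → Inside sh x → x ≢ PA.hole → entry PA.slid x ≤ k →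
               SB ∋ x × x ≢ PB.hole × entry PA.slid x ≡ entry PB.slid x
  slid-agree {x} x∈ x≢holeA slid≤k with PA.fate x x≢holeA
  ... | PA.moved {z} (i , on) next slid≡ = x∈SB , x≢holeB , slid≡B
    where
    Az≤k = subst (_≤ k) slid≡ slid≤k
    x⋖z = proj₁ (nextBox-⋖ (nextBox-sound SA A x next))
    z∈  = A.⊆shape (proj₂ (nextBox-⋖ (nextBox-sound SA A x next)))
    Ax≤k = ≤-trans (A.increasing x⋖z x∈ z∈ Az≤k) Az≤k
    x∈SB = small∈SB x∈ Ax≤k
    nextB = nextBox-agree next Az≤k
    x≢holeB : x ≢ PB.hole
    x≢holeB refl = contradiction (trans (sym nextB) PB.hole-nextBox) λ ()
    slid≡B : entry PA.slid x ≡ entry PB.slid x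
    slid≡B with PB.fate x x≢holeB
    ... | PB.moved _ nextB′ slidB≡ = begin
            entry PA.slid x ≡⟨ slid≡ ⟩
            entry A z       ≡⟨ agreeᴬ z∈ Az≤k ⟩
            entry B z       ≡⟨ cong (entry B) (just-injective (trans (sym nextB) nextB′)) ⟩
            _               ≡⟨ slidB≡ ⟨
            entry PB.slid x ∎
      where open ≡-Reasoning
    ... | PB.kept offB _ = contradiction (path-agree i on (λ _ → Ax≤k)) (offB i)
  ... | PA.kept offA slid≡ = x∈SB , x≢holeB , trans slid≡ (trans Ax≡Bx (sym slidB≡))
    where
    Ax≤k = subst (_≤ k) slid≡ slid≤k
    Ax≡Bx = agreeᴬ x∈ Ax≤k
    x∈SB = small∈SB x∈ Ax≤k
    offB : PB.OffPath x
    offB i onB = offA i (Back.path-agree i onB (λ _ → subst (_≤ k) Ax≡Bx Ax≤k))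
    x≢holeB : x ≢ PB.hole
    x≢holeB refl = offB (proj₁ PB.hole-onPath) (proj₂ PB.hole-onPath)
    slidB≡ : entry PB.slid x ≡ entry B x
    slidB≡ with PB.fate x x≢holeB
    ... | PB.moved (i , onB) _ _ = contradiction onB (offB i)
    ... | PB.kept _ eq = eq

  promoted-agree : ∀ {nA} nB → 1 ≤ k → k ≤ nA → ∀ r c → InShape sh r c →
                   PA.promoted nA r c ≤ k ∸ 1 → PA.promoted nA r c ≡ PB.promoted nB r c
  promoted-agree {nA} nB 1≤k k≤nA r c x∈ small = begin
      PA.promoted nA r c ≡⟨ PA.promoted-moved nA x∈SA x≢holeA ⟩
      PA.slid r c ∸ 1    ≡⟨ cong (_∸ 1) slid≡ ⟩
      PB.slid r c ∸ 1    ≡⟨ PB.promoted-moved nB x∈SB x≢holeB ⟨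
      PB.promoted nB r c ∎
    where
    open ≡-Reasoning
    x∈SA = proj₁ (small-promoted ip regA 1≤k k≤nA x∈ small)
    x≢holeA = proj₂ (small-promoted ip regA 1≤k k≤nA x∈ small)
    slid≤k = m∸1≤n∸1⇒m≤n 1≤k (subst (_≤ k ∸ 1) (PA.promoted-moved nA x∈SA x≢holeA) small)
    x∈SB = proj₁ (slid-agree x∈ x≢holeA slid≤k)
    x≢holeB = proj₁ (proj₂ (slid-agree x∈ x≢holeA slid≤k))
    slid≡ = proj₂ (proj₂ (slid-agree x∈ x≢holeA slid≤k))

promoteIn-agree : ∀ {sh k A B SA SB nA nB} → IsPartition sh →
                  SlideRegion sh k A SA → SlideRegion sh k B SB → 1 ≤ k → k ≤ nA → k ≤ nB →
                  AgreeUpTo sh k A B →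
                  AgreeUpTo sh (k ∸ 1) (promoteIn (size sh) SA nA A) (promoteIn (size sh) SB nB B)
promoteIn-agree {sh} ip regA regB 1≤k k≤nA k≤nB agree r c x∈ (inj₁ small) =
  SlideAgreement.promoted-agree ip regA regB agree _ 1≤k k≤nA r c x∈ small
promoteIn-agree {sh} ip regA regB 1≤k k≤nA k≤nB agree r c x∈ (inj₂ small) =
  sym (SlideAgreement.promoted-agree ip regB regA (AgreeUpTo-sym {sh} agree) _ 1≤k k≤nB r c x∈ small)

Increasing-mono : ∀ {sh K K′ T} → K′ ≤ K → Increasing sh K T → Increasing sh K′ T
Increasing-mono K′≤K inc x⋖y x∈ y∈ Ty≤K′ = inc x⋖y x∈ y∈ (≤-trans Ty≤K′ K′≤K)

AgreeUpTo-mono : ∀ {sh k k′ A B} → k′ ≤ k → AgreeUpTo sh k A B → AgreeUpTo sh k′ A B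
AgreeUpTo-mono k′≤k agree r c x∈ (inj₁ small) = agree r c x∈ (inj₁ (≤-trans small k′≤k))
AgreeUpTo-mono k′≤k agree r c x∈ (inj₂ small) = agree r c x∈ (inj₂ (≤-trans small k′≤k))

AgreeUpTo-value : ∀ {sh k A B} → AgreeUpTo sh k A B → ∀ {m} → m ≤ k →
                  ∀ r c → InShape sh r c → A r c ≡ m ⇔ B r c ≡ m
AgreeUpTo-value {k = k} agree m≤k r c x∈ = mk⇔
  (λ eq → trans (sym (agree r c x∈ (inj₁ (subst (_≤ k) (sym eq) m≤k)))) eq)
  (λ eq → trans (agree r c x∈ (inj₂ (subst (_≤ k) (sym eq) m≤k))) eq)

SYT-increasing : ∀ {sh T} → IsSYT sh T → ∀ K → Increasing sh K T
SYT-increasing syt K (right {r} {c}) _ y∈ _ = <⇒≤ (IsSYT.rowInc syt r c y∈)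
SYT-increasing syt K (below {r} {c}) _ y∈ _ = <⇒≤ (IsSYT.colInc syt r c y∈)

P-region : ∀ {sh K T} → Increasing sh K T → SlideRegion sh K T (inShapeᵇ sh)
P-region {sh} inc = record
  { ⊆shape     = λ { {r , c} x∈S → <ᵇ⇒< c (rowLen sh r) (Equivalence.from T-≡ x∈S) }
  ; ⊇small     = λ { {r , c} x∈ _ → Equivalence.to T-≡ (<⇒<ᵇ x∈) }
  ; increasing = inc
  }

PkRegion : List ℕ → ℕ → Tab → Region
PkRegion sh k T r c = inShapeᵇ sh r c ∧ (T r c ≤ᵇ k)

PkRegion-∋ : ∀ {sh k T x} → PkRegion sh k T ∋ x → Inside sh x × entry T x ≤ k
PkRegion-∋ {sh} {k} {T} {r , c} x∈S =
  let (in-shape , small) = Equivalence.to T-∧ (Equivalence.from T-≡ x∈S)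
  in <ᵇ⇒< c (rowLen sh r) in-shape , ≤ᵇ⇒≤ (T r c) k small

Pk-region : ∀ {sh k T} → Increasing sh k T → SlideRegion sh k T (PkRegion sh k T)
Pk-region {sh} {k} {T} inc = record
  { ⊆shape     = λ {x} x∈S → proj₁ (PkRegion-∋ {sh} {k} {T} {x} x∈S)
  ; ⊇small     = λ { {r , c} x∈ Tx≤k → Equivalence.to T-≡ (Equivalence.from T-∧ (<⇒<ᵇ x∈ , ≤⇒≤ᵇ Tx≤k)) }
  ; increasing = inc
  }

module _ {sh : List ℕ} (ip : IsPartition sh) {k : ℕ} (T : Tab) where
  open Promotion ip (PkRegion sh k T) T (λ {x} x∈S → proj₁ (PkRegion-∋ {sh} {k} {T} {x} x∈S))

  Pk-fixes-large : ∀ {m} → k < m → ∀ r c → Pk sh k T r c ≡ m ⇔ T r c ≡ m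
  Pk-fixes-large {m} k<m r c with (r , c) ∈? PkRegion sh k T
  ... | no x∉S  = mk⇔ (trans (sym (promoted-outside k x∉S))) (trans (promoted-outside k x∉S))
  ... | yes x∈S = mk⇔ (λ eq → contradiction (subst (_≤ k) eq Pk≤k) (<⇒≱ k<m))
                      (λ eq → contradiction (subst (_≤ k) eq (proj₂ (PkRegion-∋ {sh} {k} {T} {r , c} x∈S))) (<⇒≱ k<m))
    where
    Pk≤k : Pk sh k T r c ≤ k
    Pk≤k = promoted-≤ (λ {y} y∈S → proj₂ (PkRegion-∋ {sh} {k} {T} {y} y∈S)) ≤-refl x∈S

fpow-fixes-large : ∀ {sh} → IsPartition sh → ∀ T {j m} → size sh ∸ 2 * j < m →
                   ∀ d r c → fpow sh (d + j) T r c ≡ m ⇔ fpow sh j T r c ≡ m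
fpow-fixes-large ip T lt zero    r c = ⇔-refl
fpow-fixes-large {sh} ip T {j} lt (suc d) r c = ⇔-trans
  (Pk-fixes-large ip (fpow sh (d + j) T)
    (≤-<-trans (∸-monoʳ-≤ (size sh) (*-monoʳ-≤ 2 (m≤n+m j d))) lt) r c)
  (fpow-fixes-large ip T lt d r c)

budget-step : ∀ N j → N + 1 ∸ 2 * suc j ≡ N ∸ 2 * j ∸ 1
budget-step N j = begin
  N + 1 ∸ 2 * suc j         ≡⟨ cong₂ _∸_ (+-comm N 1) (*-suc 2 j) ⟩
  suc N ∸ suc (suc (2 * j)) ≡⟨ cong (N ∸_) (+-comm 1 (2 * j)) ⟩
  N ∸ (2 * j + 1)           ≡⟨ ∸-+-assoc N (2 * j) 1 ⟨
  N ∸ 2 * j ∸ 1             ∎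
  where open ≡-Reasoning

record FoldInvariant (sh : List ℕ) (T : Tab) (j : ℕ) : Set where
  field
    agree           : AgreeUpTo sh (size sh + 1 ∸ 2 * j) (fpow sh j T) (Ppow sh j T)
    fpow-increasing : Increasing sh (size sh ∸ 2 * j) (fpow sh j T)
    Ppow-increasing : Increasing sh (size sh ∸ 2 * j) (Ppow sh j T)

fold-invariant : ∀ {sh T} → IsPartition sh → IsSYT sh T → ∀ j → 2 * j ≤ size sh → FoldInvariant sh T j
fold-invariant ip syt zero _ = record
  { agree           = λ _ _ _ _ → refl
  ; fpow-increasing = SYT-increasing syt _
  ; Ppow-increasing = SYT-increasing syt _
  }
fold-invariant {sh} {T} ip syt (suc j) 2j+2≤N = record
  { agree           = subst (λ b → AgreeUpTo sh b (fpow sh (suc j) T) (Ppow sh (suc j) T))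
                            (sym (budget-step N j))
                            (promoteIn-agree ip (Pk-region {sh} IH.fpow-increasing) (P-region {sh} IH.Ppow-increasing)
                              1≤k ≤-refl k≤N (AgreeUpTo-mono {sh} (∸-monoˡ-≤ (2 * j) (m≤m+n N 1)) IH.agree))
  ; fpow-increasing = Increasing-mono {sh} next≤k∸1 (promoteIn-increasing ip (Pk-region {sh} IH.fpow-increasing) 1≤k ≤-refl)
  ; Ppow-increasing = Increasing-mono {sh} next≤k∸1 (promoteIn-increasing ip (P-region {sh} IH.Ppow-increasing) 1≤k k≤N)
  }
  where
  N = size sh
  k = N ∸ 2 * j
  module IH = FoldInvariant (fold-invariant ip syt j (≤-trans (*-monoʳ-≤ 2 (n≤1+n j)) 2j+2≤N))
  1≤k : 1 ≤ k
  1≤k = m<n⇒0<n∸m (<-≤-trans (*-monoʳ-< 2 (n<1+n j)) 2j+2≤N)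
  k≤N : k ≤ N
  k≤N = m∸n≤m N (2 * j)
  next≤k∸1 : N ∸ 2 * suc j ≤ k ∸ 1
  next≤k∸1 = ≤-trans (∸-monoˡ-≤ (2 * suc j) (m≤m+n N 1)) (≤-reflexive (budget-step N j))

m≤⌊n/2⌋⇒2*m≤n : ∀ {m n} → m ≤ ⌊ n /2⌋ → 2 * m ≤ n
m≤⌊n/2⌋⇒2*m≤n {m} {n} m≤ = begin
  2 * m               ≤⟨ *-monoʳ-≤ 2 m≤ ⟩
  ⌊ n /2⌋ + (⌊ n /2⌋ + 0) ≡⟨ cong (⌊ n /2⌋ +_) (+-identityʳ ⌊ n /2⌋) ⟩
  ⌊ n /2⌋ + ⌊ n /2⌋   ≤⟨ +-monoʳ-≤ ⌊ n /2⌋ (⌊n/2⌋≤⌈n/2⌉ n) ⟩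
  ⌊ n /2⌋ + ⌈ n /2⌉   ≡⟨ ⌊n/2⌋+⌈n/2⌉≡n n ⟩
  n                   ∎
  where open ≤-Reasoning

lemma2p5 : (sh : List ℕ) → IsPartition sh → (T : Tab) → IsSYT sh T →
           (j : ℕ) → 1 ≤ j → j ≤ ⌊ size sh /2⌋ →
           (∀ r c → InShape sh r c →
              (fpow sh j T r c ≤ size sh + 1 ∸ 2 * j) ⊎ (Ppow sh j T r c ≤ size sh + 1 ∸ 2 * j) →
              fpow sh j T r c ≡ Ppow sh j T r c)
           × (∀ r c → InShape sh r c →
              (Fold sh T r c ≡ size sh + 1 ∸ 2 * j → Ppow sh j T r c ≡ size sh + 1 ∸ 2 * j)
              × (Ppow sh j T r c ≡ size sh + 1 ∸ 2 * j → Fold sh T r c ≡ size sh + 1 ∸ 2 * j))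
lemma2p5 sh ip T syt j _ j≤⌊N/2⌋ =
  agree , λ r c x∈ → Equivalence.to (Fold⇔Ppow r c x∈) , Equivalence.from (Fold⇔Ppow r c x∈)
  where
  N = size sh
  2j≤N = m≤⌊n/2⌋⇒2*m≤n j≤⌊N/2⌋
  agree = FoldInvariant.agree (fold-invariant ip syt j 2j≤N)
  N∸2j<N+1∸2j : N ∸ 2 * j < N + 1 ∸ 2 * j
  N∸2j<N+1∸2j = subst (N ∸ 2 * j <_) (sym (+-∸-comm 1 2j≤N)) (m<m+n (N ∸ 2 * j) z<s)
  Fold⇔Ppow : ∀ r c → InShape sh r c → Fold sh T r c ≡ N + 1 ∸ 2 * j ⇔ Ppow sh j T r c ≡ N + 1 ∸ 2 * j
  Fold⇔Ppow r c x∈ = ⇔-trans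
    (subst (λ i → fpow sh i T r c ≡ N + 1 ∸ 2 * j ⇔ fpow sh j T r c ≡ N + 1 ∸ 2 * j) (m∸n+n≡m j≤⌊N/2⌋)
           (fpow-fixes-large ip T N∸2j<N+1∸2j (⌊ N /2⌋ ∸ j) r c))
    (AgreeUpTo-value {sh} agree ≤-refl r c x∈)
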